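{- For an integer $n\ge 0$, $s(n)=n$ if and only if $n\equiv 0\pmod 4$ and $n$ does not belong to any of the sets $Q_r=\{2^{4r}j-4r : j\ge 1\}$, $r=1,2,3,\dots$.
   Context: For integers $m\ge 0$, $k\ge0$ let $\operatorname{bit}_k(m)=\lfloor m/2^k\rfloor\bmod 2$. For $n\ge 0$ the sloping binary number is $s(n)=\sum_{k\ge 0}\operatorname{bit}_k(n+k)2^k$ (the $2^k$ digit of $s(n)$ is the $2^k$ digit of $n+k$). -}

module Defs where

open import Data.Nat using (ℕ; zero; suc; _+_; _*_; _^_; _/_; _%_)
open import Data.Nat.Properties using (m^n≢0)

bit : ℕ → ℕ → ℕ
bit k m = (_/_ m (2 ^ k) {{m^n≢0 2 k}}) % 2

sAux : ℕ → ℕ → ℕ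
sAux n zero = 0
sAux n (suc K) = sAux n K + bit K (n + K) * 2 ^ K

-- s(n) = Σ_{k ≥ 0} bit_k(n+k) 2^k.  All terms with k ≥ n+1 vanish since
-- n + k < 2^k there, so the sum over k < n+1 is the full sum.
s : ℕ → ℕ
s n = sAux n (suc n)

{-# OPTIONS --safe #-}
-- The 2^k digits of s(n) and n agree iff adding k to n does not carry into
-- the 2^k digit, i.e. iff n mod 2^k + k < 2^k; for k > n this holds anyway, so
-- s(n) = n iff it holds for every k.  Since n mod 2^(k+1) ≤ n mod 2^k + 2^k,
-- if the inequality ever fails, it first fails with n mod 2^k + k = 2^k, i.e.
-- with 2^k ∣ n + k.  For k = 1, 2 this excludes n odd and n ≡ 2 (mod 4); once
-- 4 ∣ n, 2^k ∣ n + k with k ≥ 2 forces 4 ∣ k, i.e. n ∈ Q_(k/4).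
module Submission where

open import Defs
open import Data.Nat
  using (ℕ; zero; suc; _+_; _*_; _^_; _%_; _/_; _≤_; _<_; _≥_; z≤n; s≤s; z<s; NonZero)
open import Data.Nat.Properties
open import Data.Nat.DivMod
open import Data.Nat.Divisibility
  using ( _∣_; _∤_; divides; ∣-refl; ∣-trans; ∣m+n∣m⇒∣n; m∣m*n; *-pres-∣; >⇒∤
        ; n∣m⇒m%n≡0; m%n≡0⇒n∣m)
open import Data.Nat.Solver using (module +-*-Solver)
open import Data.Product using (Σ; _×_; _,_)
open import Data.Sum using (inj₁; inj₂)
open import Function using (_∘_; case_of_)
open import Function.Bundles using (_⇔_; mk⇔; Equivalence)
open import Relation.Binary.PropositionalEquality
open import Relation.Nullary using (¬_; yes; no; contradiction)

open +-*-Solver using (solve; _:+_; _:=_; con)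
open Equivalence using (to; from)

m<n⇒[m+kn]%n≡m : ∀ {m k n} .{{_ : NonZero n}} → m < n → (m + k * n) % n ≡ m
m<n⇒[m+kn]%n≡m {m} {k} {n} m<n = trans ([m+kn]%n≡m%n m k n) (m<n⇒m%n≡m m<n)

m<n⇒[m+kn]/n≡k : ∀ {m k n} .{{_ : NonZero n}} → m < n → (m + k * n) / n ≡ k
m<n⇒[m+kn]/n≡k {m} {k} {n} m<n = begin
  (m + k * n) / n    ≡⟨ +-distrib-/-∣ʳ m (divides k refl) ⟩
  m / n + k * n / n  ≡⟨ cong₂ _+_ (m<n⇒m/n≡0 m<n) (m*n/n≡m k n) ⟩
  k                  ∎
  where open ≡-Reasoning

m+kn≡o+ln⇒m≡o×k≡l : ∀ {m o k l n} .{{_ : NonZero n}} → m < n → o < n →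
                m + k * n ≡ o + l * n → m ≡ o × k ≡ l
m+kn≡o+ln⇒m≡o×k≡l {k = k} {l} {n} m<n o<n eq =
    trans (sym (m<n⇒[m+kn]%n≡m {k = k} m<n)) (trans (cong (_% n) eq) (m<n⇒[m+kn]%n≡m {k = l} o<n))
  , trans (sym (m<n⇒[m+kn]/n≡k {k = k} m<n)) (trans (cong (_/ n) eq) (m<n⇒[m+kn]/n≡k {k = l} o<n))

m+o≡[m%n+o]+[m/n]*n : ∀ m o n .{{_ : NonZero n}} → m + o ≡ (m % n + o) + m / n * n
m+o≡[m%n+o]+[m/n]*n m o n = begin
  m + o                  ≡⟨ cong (_+ o) (m≡m%n+[m/n]*n m n) ⟩
  m % n + m / n * n + o  ≡⟨ swap (m % n) (m / n * n) o ⟩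
  m % n + o + m / n * n  ∎
  where
  open ≡-Reasoning
  swap : ∀ r q o → r + q + o ≡ r + o + q
  swap = solve 3 (λ r q o → r :+ q :+ o := r :+ o :+ q) refl

[m+o]/n≡[m%n+o]/n+m/n : ∀ m o n .{{_ : NonZero n}} → (m + o) / n ≡ (m % n + o) / n + m / n
[m+o]/n≡[m%n+o]/n+m/n m o n = begin
  (m + o) / n                      ≡⟨ /-congˡ (m+o≡[m%n+o]+[m/n]*n m o n) ⟩
  (m % n + o + m / n * n) / n      ≡⟨ +-distrib-/-∣ʳ (m % n + o) (divides (m / n) refl) ⟩
  (m % n + o) / n + m / n * n / n  ≡⟨ cong ((m % n + o) / n +_) (m*n/n≡m (m / n) n) ⟩
  (m % n + o) / n + m / n          ∎
  where open ≡-Reasoning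

m%n+o<n⇒[m+o]%n≡m%n+o : ∀ m o n .{{_ : NonZero n}} → m % n + o < n → (m + o) % n ≡ m % n + o
m%n+o<n⇒[m+o]%n≡m%n+o m o n lt =
  trans (%-congˡ (m+o≡[m%n+o]+[m/n]*n m o n)) (m<n⇒[m+kn]%n≡m {k = m / n} lt)

m%n+o≡n⇒n∣m+o : ∀ m o n .{{_ : NonZero n}} → m % n + o ≡ n → n ∣ m + o
m%n+o≡n⇒n∣m+o m o n eq =
  divides (suc (m / n)) (trans (m+o≡[m%n+o]+[m/n]*n m o n) (cong (_+ m / n * n) eq))

[1+q]%2≢q%2 : ∀ q → suc q % 2 ≢ q % 2
[1+q]%2≢q%2 zero ()
[1+q]%2≢q%2 (suc zero) ()
[1+q]%2≢q%2 (suc (suc q)) = [1+q]%2≢q%2 q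

n<2^n : ∀ n → n < 2 ^ n
n<2^n zero = z<s
n<2^n (suc n) = +-mono-≤ (m^n>0 2 n) (≤-trans (n<2^n n) (m≤m+n _ 0))

n<k⇒n+k<2^k : ∀ {n k} → n < k → n + k < 2 ^ k
n<k⇒n+k<2^k {k = suc k} (s≤s n≤k) =
  +-mono-≤ (≤-<-trans n≤k (n<2^n k)) (≤-trans (n<2^n k) (m≤m+n _ 0))

-- A global instance NonZero (2 ^ k) would make instance search on numerals
-- ambiguous (2 ^ ?k = 2 is stuck), hence this operator.
infixl 7 _%2^_

_%2^_ : ℕ → ℕ → ℕ
n %2^ k = _%_ n (2 ^ k) {{m^n≢0 2 k}}

%2^<2^ : ∀ n k → n %2^ k < 2 ^ k
%2^<2^ n k = m%n<n n (2 ^ k) {{m^n≢0 2 k}}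

bit<2 : ∀ k n → bit k n < 2
bit<2 k n = m%n<n (_/_ n (2 ^ k) {{m^n≢0 2 k}}) 2

%2^suc : ∀ n k → n %2^ suc k ≡ n %2^ k + bit k n * 2 ^ k
%2^suc n k = begin
  n % (2 * P)                            ≡⟨ m≡m%n+[m/n]*n (n % (2 * P)) P ⟩
  n % (2 * P) % P + n % (2 * P) / P * P  ≡⟨ cong₂ (λ r b → r + b * P)
                                             (m∣n⇒o%n%m≡o%m P (2 * P) n (divides 2 refl))
                                             (m%[n*o]/o≡m/o%n n 2 P) ⟩
  n % P + n / P % 2 * P                  ∎
  where
  open ≡-Reasoning
  P = 2 ^ k
  instance
    _ = m^n≢0 2 k
    _ = m^n≢0 2 (suc k)

bit-+≡bit⇔%2^+<2^ : ∀ k n m → m ≤ 2 ^ k → bit k (n + m) ≡ bit k n ⇔ n %2^ k + m < 2 ^ k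
bit-+≡bit⇔%2^+<2^ k n m m≤P = mk⇔ no-carry carry-free
  where
  instance _ = m^n≢0 2 k
  P = 2 ^ k
  carry = (n % P + m) / P
  bit-+≡ : bit k (n + m) ≡ (carry + n / P) % 2
  bit-+≡ = cong (_% 2) ([m+o]/n≡[m%n+o]/n+m/n n m P)
  carry≤1 : carry ≤ 1
  carry≤1 = ≤-pred (m<n*o⇒m/o<n (+-mono-<-≤ (m%n<n n P) (≤-trans m≤P (m≤m+n P 0))))
  carry-free : n % P + m < P → bit k (n + m) ≡ bit k n
  carry-free lt = trans bit-+≡ (cong (λ c → (c + n / P) % 2) (m<n⇒m/n≡0 lt))
  no-carry : bit k (n + m) ≡ bit k n → n % P + m < P
  no-carry eq = ≰⇒> λ P≤ →
    [1+q]%2≢q%2 (n / P) (begin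
      suc (n / P) % 2       ≡⟨ cong (λ c → (c + n / P) % 2) (≤-antisym (m≥n⇒m/n>0 P≤) carry≤1) ⟩
      (carry + n / P) % 2   ≡⟨ bit-+≡ ⟨
      bit k (n + m)         ≡⟨ eq ⟩
      n / P % 2             ∎)
    where open ≡-Reasoning

sAux<2^ : ∀ n K → sAux n K < 2 ^ K
sAux<2^ n zero = z<s
sAux<2^ n (suc K) = +-mono-<-≤ (sAux<2^ n K) (*-monoˡ-≤ (2 ^ K) (≤-pred (bit<2 K (n + K))))

sAux-suc≡%2^⇔ : ∀ n K →
  sAux n (suc K) ≡ n %2^ suc K ⇔ (sAux n K ≡ n %2^ K × bit K (n + K) ≡ bit K n)
sAux-suc≡%2^⇔ n K = mk⇔
  (λ eq → m+kn≡o+ln⇒m≡o×k≡l {{m^n≢0 2 K}} (sAux<2^ n K) (%2^<2^ n K) (trans eq (%2^suc n K)))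
  (λ (eq , bit≡) → trans (cong₂ (λ r b → r + b * 2 ^ K) eq bit≡) (sym (%2^suc n K)))

BitsAgree : ℕ → ℕ → Set
BitsAgree n K = ∀ k → k < K → bit k (n + k) ≡ bit k n

sAux≡%2^⇔BitsAgree : ∀ n K → sAux n K ≡ n %2^ K ⇔ BitsAgree n K
sAux≡%2^⇔BitsAgree n zero = mk⇔ (λ _ _ ()) (λ _ → sym (n%1≡0 n))
sAux≡%2^⇔BitsAgree n (suc K) = mk⇔ agree (from step ∘ split)
  where
  IH = sAux≡%2^⇔BitsAgree n K
  step = sAux-suc≡%2^⇔ n K
  agree : sAux n (suc K) ≡ n %2^ suc K → BitsAgree n (suc K)
  agree eq k k<1+K with to step eq | m<1+n⇒m<n∨m≡n k<1+K
  ... | eqK , _ | inj₁ k<K = to IH eqK k k<K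
  ... | _ , bit≡ | inj₂ refl = bit≡
  split : BitsAgree n (suc K) → sAux n K ≡ n %2^ K × bit K (n + K) ≡ bit K n
  split all = from IH (λ k k<K → all k (m<n⇒m<1+n k<K)) , all K (n<1+n K)

NoCarry : ℕ → Set
NoCarry n = ∀ k → n %2^ k + k < 2 ^ k

s≡n⇔NoCarry : ∀ n → s n ≡ n ⇔ NoCarry n
s≡n⇔NoCarry n = mk⇔ (bits-agree⇒NoCarry ∘ to prefix) (from prefix ∘ NoCarry⇒bits-agree)
  where
  n%2^[1+n]≡n : n %2^ suc n ≡ n
  n%2^[1+n]≡n = m<n⇒m%n≡m {{m^n≢0 2 (suc n)}} (<-trans (n<1+n n) (n<2^n (suc n)))
  prefix : s n ≡ n ⇔ BitsAgree n (suc n)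
  prefix = subst (λ x → s n ≡ x ⇔ BitsAgree n (suc n)) n%2^[1+n]≡n
                 (sAux≡%2^⇔BitsAgree n (suc n))
  digit : ∀ k → bit k (n + k) ≡ bit k n ⇔ n %2^ k + k < 2 ^ k
  digit k = bit-+≡bit⇔%2^+<2^ k n k (<⇒≤ (n<2^n k))
  NoCarry⇒bits-agree : NoCarry n → BitsAgree n (suc n)
  NoCarry⇒bits-agree nc k _ = from (digit k) (nc k)
  bits-agree⇒NoCarry : BitsAgree n (suc n) → NoCarry n
  bits-agree⇒NoCarry agree k with k <? suc n
  ... | yes k≤n = to (digit k) (agree k k≤n)
  ... | no k≮1+n =
    subst (λ r → r + k < 2 ^ k) (sym (m<n⇒m%n≡m {{m^n≢0 2 k}} n<2^k)) (n<k⇒n+k<2^k n<k′)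
    where
    n<k′ : n < k
    n<k′ = ≤-pred (≰⇒> k≮1+n)
    n<2^k : n < 2 ^ k
    n<2^k = <-trans n<k′ (n<2^n k)

%2^+k<2^k⇒%2^[1+k]+[1+k]≤2^[1+k] : ∀ n k →
  n %2^ k + k < 2 ^ k → n %2^ suc k + suc k ≤ 2 ^ suc k
%2^+k<2^k⇒%2^[1+k]+[1+k]≤2^[1+k] n k lt = begin
  n %2^ suc k + suc k              ≡⟨ cong (_+ suc k) (%2^suc n k) ⟩
  n %2^ k + bit k n * P + suc k    ≤⟨ +-monoˡ-≤ (suc k) (+-monoʳ-≤ (n %2^ k) bit*P≤P+0) ⟩
  n %2^ k + (P + 0) + suc k        ≡⟨ regroup (n %2^ k) P k ⟩
  suc (n %2^ k + k) + P            ≤⟨ +-monoˡ-≤ P lt ⟩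
  P + P                            ≤⟨ +-monoʳ-≤ P (m≤m+n P 0) ⟩
  2 * P                            ∎
  where
  open ≤-Reasoning
  P = 2 ^ k
  bit*P≤P+0 : bit k n * P ≤ 1 * P
  bit*P≤P+0 = *-monoˡ-≤ P (≤-pred (bit<2 k n))
  regroup : ∀ r P k → r + (P + 0) + suc k ≡ suc (r + k) + P
  regroup = solve 3 (λ r P k → r :+ (P :+ con 0) :+ (con 1 :+ k) := (con 1 :+ r :+ k) :+ P) refl

NoCarry⇔∤ : ∀ n → NoCarry n ⇔ (∀ k → 0 < k → 2 ^ k ∤ n + k)
NoCarry⇔∤ n = mk⇔ NoCarry⇒∤ ∤⇒NoCarry
  where
  NoCarry⇒∤ : NoCarry n → ∀ k → 0 < k → 2 ^ k ∤ n + k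
  NoCarry⇒∤ nc k@(suc _) _ 2^k∣n+k = case m+n≡0⇒n≡0 (n %2^ k) (begin
      n %2^ k + k         ≡⟨ m%n+o<n⇒[m+o]%n≡m%n+o n k (2 ^ k) (nc k) ⟨
      (n + k) % 2 ^ k     ≡⟨ n∣m⇒m%n≡0 (n + k) (2 ^ k) 2^k∣n+k ⟩
      0                   ∎) of λ ()
    where
    open ≡-Reasoning
    instance _ = m^n≢0 2 k
  ∤⇒NoCarry : (∀ k → 0 < k → 2 ^ k ∤ n + k) → NoCarry n
  ∤⇒NoCarry _ zero = subst (λ r → r + 0 < 1) (sym (n%1≡0 n)) z<s
  ∤⇒NoCarry no∣ (suc k)
    with m≤n⇒m<n∨m≡n (%2^+k<2^k⇒%2^[1+k]+[1+k]≤2^[1+k] n k (∤⇒NoCarry no∣ k))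
  ... | inj₁ lt = lt
  ... | inj₂ eq =
    contradiction (m%n+o≡n⇒n∣m+o n (suc k) (2 ^ suc k) {{m^n≢0 2 (suc k)}} eq) (no∣ (suc k) z<s)

NoCarry⇒4∣n : ∀ {n} → NoCarry n → n % 4 ≡ 0
NoCarry⇒4∣n {n} nc = trans n%4≡bit₁*2 (cong (_* 2) (n<1⇒n≡0 bit₁<1))
  where
  n%2≡0 : n % 2 ≡ 0
  n%2≡0 = n<1⇒n≡0 (+-cancelʳ-< 1 (n % 2) 1 (nc 1))
  n%4≡bit₁*2 : n % 4 ≡ bit 1 n * 2
  n%4≡bit₁*2 = trans (%2^suc n 1) (cong (_+ bit 1 n * 2) n%2≡0)
  bit₁<1 : bit 1 n < 1
  bit₁<1 = *-cancelʳ-< 2 (bit 1 n) 1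
             (subst (_< 2) n%4≡bit₁*2 (+-cancelʳ-< 2 (n % 4) 2 (nc 2)))

InSomeQ : ℕ → Set
InSomeQ n = Σ ℕ λ r → Σ ℕ λ j → (r ≥ 1) × (j ≥ 1) × (n + 4 * r ≡ 2 ^ (4 * r) * j)

NoCarry⇒∉Q : ∀ {n} → NoCarry n → ¬ InSomeQ n
NoCarry⇒∉Q {n} nc (r@(suc _) , j , _ , _ , eq) =
  to (NoCarry⇔∤ n) nc (4 * r) z<s (divides j (trans eq (*-comm (2 ^ (4 * r)) j)))

4∣n⇒∉Q⇒∤ : ∀ {n} → 4 ∣ n → ¬ InSomeQ n → ∀ k → 0 < k → 2 ^ k ∤ n + k
4∣n⇒∉Q⇒∤ 4∣n _ 1 _ 2∣n+1 =
  >⇒∤ (s≤s (s≤s z≤n)) (∣m+n∣m⇒∣n 2∣n+1 (∣-trans (divides 2 refl) 4∣n))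
4∣n⇒∉Q⇒∤ {n} _ _ (suc (suc _)) _ (divides zero n+k≡0) =
  contradiction (m+n≡0⇒n≡0 n n+k≡0) λ ()
4∣n⇒∉Q⇒∤ {n} 4∣n ∉Q k@(suc (suc k′)) _ 2^k∣n+k@(divides j@(suc _) n+k≡j*2^k)
  with ∣m+n∣m⇒∣n (∣-trans 4∣2^k 2^k∣n+k) 4∣n
  where
  4∣2^k : 4 ∣ 2 ^ k
  4∣2^k = *-pres-∣ {2} {2} {2} {2 * 2 ^ k′} ∣-refl (m∣m*n (2 ^ k′))
... | divides zero ()
... | divides r@(suc _) k≡r*4 =
  ∉Q (r , j , s≤s z≤n , s≤s z≤n ,
      subst (λ k → n + k ≡ 2 ^ k * j) (trans k≡r*4 (*-comm r 4))
            (trans n+k≡j*2^k (*-comm j (2 ^ k))))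

theorem5 : (n : ℕ) →
    (s n ≡ n) ⇔
      ((n % 4 ≡ 0) ×
       ¬ (Σ ℕ λ r → Σ ℕ λ j → (r ≥ 1) × (j ≥ 1) × (n + 4 * r ≡ 2 ^ (4 * r) * j)))
theorem5 n = mk⇔
  (λ s≡n → let nc = to (s≡n⇔NoCarry n) s≡n in NoCarry⇒4∣n nc , NoCarry⇒∉Q nc)
  (λ (n%4≡0 , ∉Q) → from (s≡n⇔NoCarry n)
     (from (NoCarry⇔∤ n) (4∣n⇒∉Q⇒∤ (m%n≡0⇒n∣m n 4 n%4≡0) ∉Q)))
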